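{- Let $p$ and $q$ be primes with $p\mid q-1$, let $r\in\mathbb Z$ satisfy $r^p\equiv 1\pmod q$ and $r\not\equiv1\pmod q$, and let $F_{pq}=\langle \alpha,\tau:\ \alpha^q=1,\ \tau^p=1,\ \alpha\tau=\tau\alpha^r\rangle$. Then $\mathsf D(F_{pq})\geq 2q$.
   Context: A sequence over a finite group $G$ is a finite unordered list of elements of $G$ with repetition allowed; its length is its number of terms with multiplicity. It is product-one if its terms can be ordered so that their product is the identity. A minimal product-one sequence is a nonempty product-one sequence that cannot be partitioned into two nonempty product-one subsequences. $\mathsf D(G)$ is the maximal length of a minimal product-one sequence over $G$. -}

module Defs where

open import Data.Nat as ℕ using (ℕ)
open import Data.Integer as ℤ using (ℤ; +_; _-_)
open import Data.Integer.Divisibility as ℤD using ()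
open import Data.Product using (_×_; _,_; ∃; ∃-syntax)
open import Data.List using (List; []; _∷_; _++_; foldr; length)
open import Data.List.Relation.Binary.Permutation.Propositional using (_↭_)
open import Relation.Nullary using (¬_)
open import Relation.Binary.PropositionalEquality using (_≡_; _≢_)

_≡_[mod_] : ℤ → ℤ → ℕ → Set
a ≡ b [mod m ] = (+ m) ℤD.∣ (a - b)

-- An element (t , a) represents τ^t α^a, with t taken mod p and a taken mod q.
-- Multiplication: (τ^t α^a)(τ^s α^b) = τ^(t+s) α^(a r^s + b).
module Fpq (p q : ℕ) (r : ℤ) where

  G : Set
  G = ℕ × ℤ

  _≈_ : G → G → Set
  (t , a) ≈ (s , b) = (+ t) ≡ (+ s) [mod p ] × a ≡ b [mod q ]

  _·_ : G → G → G
  (t , a) · (s , b) = (t ℕ.+ s , a ℤ.* (r ℤ.^ s) ℤ.+ b)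

  e : G
  e = (0 , + 0)

  α : G
  α = (0 , + 1)

  τ : G
  τ = (1 , + 0)

  -- Sequences over F_pq: lists (unordered via permutation ↭).
  prod : List G → G
  prod = foldr _·_ e

  ProductOne : List G → Set
  ProductOne S = ∃[ T ] (T ↭ S × prod T ≈ e)

  MinimalProductOne : List G → Set
  MinimalProductOne S =
    S ≢ [] × ProductOne S ×
    ¬ (∃[ T ] ∃[ U ] (S ↭ T ++ U × T ≢ [] × U ≢ [] × ProductOne T × ProductOne U))

  -- D(F_pq) ≥ n  iff  some minimal product-one sequence has length ≥ n
  -- (D is the maximum of such lengths)
  D≥ : ℕ → Set
  D≥ n = ∃[ S ] (MinimalProductOne S × n ℕ.≤ length S)

-- Let s = r^(p-1) and η = τ⁻¹ α^(s+1). The sequence S = α^(q-1) τ α^(q-1) η has 2q terms and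
-- product 1. Suppose S splits into two product-one parts. The τ-exponent of a part is
-- #τ + (p-1)·#η mod p, so τ and η lie in the same part, and the other part is α^n with q ∣ n and
-- 0 < n ≤ 2q-2, i.e. n = q. The first part then consists of τ, η and q-2 copies of α; in any
-- order α^a τ α^b η α^c or α^a η α^b τ α^c its α-exponent is congruent mod q to (b+1)(s-1) or
-- (b+1)(r-1), which is nonzero since q is prime, 0 < b+1 < q, and r, s ≢ 1 because rs = r^p ≡ 1.
module Submission where

open import Defs
open import Data.Nat using (ℕ; zero; suc; z≤n; s≤s; _<_)
import Data.Nat.Properties as ℕP
open import Data.Nat.Divisibility as ℕD using (divides)
open import Data.Nat.Primality using (Prime; euclidsLemma)
open import Data.Integer as ℤ using (ℤ; +_; 0ℤ; 1ℤ)
import Data.Integer.Properties as ℤP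
import Data.Integer.Divisibility.Signed as ℤS
open import Data.Product using (_×_; _,_; proj₁; proj₂; ∃₂; ∃-syntax)
open import Data.Sum using (_⊎_; inj₁; inj₂; [_,_])
open import Data.List using (List; []; _∷_; _++_; map; replicate; length)
open import Data.List.Properties using (∷-injective; map-++; length-map; length-++; length-replicate)
open import Data.List.Relation.Binary.Permutation.Propositional using (_↭_; ↭-refl; ↭-sym; ↭-trans)
open import Data.List.Relation.Binary.Permutation.Propositional.Properties using (↭-map-inv; ↭-empty-inv; map⁺; ++⁺)
open import Data.Nat.ListAction using (sum)
open import Data.Nat.ListAction.Properties using (sum-++; sum-↭)
open import Data.Empty using (⊥; ⊥-elim)
open import Function using (_∘_)
open import Level using (0ℓ)
open import Relation.Binary.Bundles using (Setoid)
import Relation.Binary.Reasoning.Setoid as SetoidReasoning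
open import Relation.Nullary using (¬_)
open import Relation.Binary.PropositionalEquality
  using (_≡_; _≢_; refl; sym; trans; cong; cong₂; subst; subst₂; module ≡-Reasoning)

module _ {a b} {A : Set a} {B : Set b} (f : A → B) where

  map-++⁻ : ∀ xs {ys zs} → map f xs ≡ ys ++ zs →
            ∃₂ λ ys′ zs′ → xs ≡ ys′ ++ zs′ × ys ≡ map f ys′ × zs ≡ map f zs′
  map-++⁻ xs       {[]}     eq = [] , xs , refl , refl , sym eq
  map-++⁻ []       {_ ∷ _}  ()
  map-++⁻ (x ∷ xs) {_ ∷ ys} eq with refl , eq′ ← ∷-injective eq
    with ys′ , zs′ , refl , refl , refl ← map-++⁻ xs {ys} eq′ = x ∷ ys′ , zs′ , refl , refl , refl

  ↭-map-++⁻ : ∀ {xs ys zs} → map f xs ↭ ys ++ zs →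
              ∃₂ λ ys′ zs′ → xs ↭ ys′ ++ zs′ × ys ≡ map f ys′ × zs ≡ map f zs′
  ↭-map-++⁻ {ys = ys} ρ with ws , eq , ρ′ ← ↭-map-inv f ρ
    with ys′ , zs′ , refl , refl , refl ← map-++⁻ ws {ys} (sym eq) = ys′ , zs′ , ρ′ , refl , refl

-- The congruence of Defs unfolds to divisibility of an absolute value, from which Agda
-- cannot infer the two integers; this wrapper is injective in them.
record Mod (n : ℕ) (a b : ℤ) : Set where
  constructor mod
  field unmod : a ≡ b [mod n ]
open Mod public

module _ {n : ℕ} where
  open import Data.Integer using (_+_; _-_; _*_; -_)
  open import Data.Integer.Tactic.RingSolver using (solve-∀)

  private
    signed : ∀ {a b} → Mod n a b → + n ℤS.∣ a - b
    signed = ℤS.∣ᵤ⇒∣ ∘ unmod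

    unsigned : ∀ {a b} → + n ℤS.∣ a - b → Mod n a b
    unsigned = mod ∘ ℤS.∣⇒∣ᵤ

  mod-refl : ∀ {a} → Mod n a a
  mod-refl {a} = mod (subst (λ x → n ℕD.∣ ℤ.∣ x ∣) (sym (ℤP.+-inverseʳ a)) (n ℕD.∣0))

  mod-sym : ∀ {a b} → Mod n a b → Mod n b a
  mod-sym {a} {b} = unsigned ∘ subst (+ n ℤS.∣_) (negate a b) ∘ ℤS.∣m⇒∣-m ∘ signed
    where
    negate : ∀ a b → - (a - b) ≡ b - a
    negate = solve-∀

  mod-trans : ∀ {a b c} → Mod n a b → Mod n b c → Mod n a c
  mod-trans {a} {b} {c} ab bc =
    unsigned (subst (+ n ℤS.∣_) (telescope a b c) (ℤS.∣m∣n⇒∣m+n (signed ab) (signed bc)))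
    where
    telescope : ∀ a b c → (a - b) + (b - c) ≡ a - c
    telescope = solve-∀

  mod-+-cong : ∀ {a b c d} → Mod n a b → Mod n c d → Mod n (a + c) (b + d)
  mod-+-cong {a} {b} {c} {d} ab cd =
    unsigned (subst (+ n ℤS.∣_) (regroup a b c d) (ℤS.∣m∣n⇒∣m+n (signed ab) (signed cd)))
    where
    regroup : ∀ a b c d → (a - b) + (c - d) ≡ (a + c) - (b + d)
    regroup = solve-∀

  mod-+-congʳ : ∀ c {a b} → Mod n a b → Mod n (a + c) (b + c)
  mod-+-congʳ c ab = mod-+-cong ab (mod-refl {c})

  mod-*-congˡ : ∀ c {a b} → Mod n a b → Mod n (c * a) (c * b)
  mod-*-congˡ c {a} {b} = unsigned ∘ subst (+ n ℤS.∣_) (distrib c a b) ∘ ℤS.∣n⇒∣m*n c ∘ signed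
    where
    distrib : ∀ c a b → c * (a - b) ≡ c * a - c * b
    distrib = solve-∀

  mod-*-congʳ : ∀ c {a b} → Mod n a b → Mod n (a * c) (b * c)
  mod-*-congʳ c {a} {b} ab = subst₂ (Mod n) (ℤP.*-comm c a) (ℤP.*-comm c b) (mod-*-congˡ c ab)

  mod-zero⁻ : ∀ {a} → Mod n a 0ℤ → n ℕD.∣ ℤ.∣ a ∣
  mod-zero⁻ {a} = subst (λ x → n ℕD.∣ ℤ.∣ x ∣) (ℤP.+-identityʳ a) ∘ unmod

  mod-zero⁺ : ∀ {a} → n ℕD.∣ ℤ.∣ a ∣ → Mod n a 0ℤ
  mod-zero⁺ {a} = mod ∘ subst (λ x → n ℕD.∣ ℤ.∣ x ∣) (sym (ℤP.+-identityʳ a))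

  mod-diff⁻ : ∀ {a b} → Mod n (a - b) 0ℤ → Mod n a b
  mod-diff⁻ {a} {b} = mod ∘ mod-zero⁻ {a - b}

  ∣⇒mod-zero : ∀ {k} → n ℕD.∣ k → Mod n (+ k) 0ℤ
  ∣⇒mod-zero = mod-zero⁺

  mod-self : Mod n (+ n) 0ℤ
  mod-self = ∣⇒mod-zero ℕD.∣-refl

  mod-euclid : Prime n → ∀ a b → Mod n (a * b) 0ℤ → Mod n a 0ℤ ⊎ Mod n b 0ℤ
  mod-euclid n-prime a b ab≡0 =
    [ inj₁ ∘ mod-zero⁺ {a} , inj₂ ∘ mod-zero⁺ {b} ]
      (euclidsLemma ℤ.∣ a ∣ ℤ.∣ b ∣ n-prime (subst (n ℕD.∣_) (ℤP.abs-* a b) (mod-zero⁻ ab≡0)))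

mod-setoid : ℕ → Setoid 0ℓ 0ℓ
mod-setoid n = record
  { Carrier       = ℤ
  ; _≈_           = Mod n
  ; isEquivalence = record { refl = mod-refl ; sym = mod-sym ; trans = mod-trans }
  }

module _ where
  open import Data.Nat using (_+_; _*_)

  +≡1-split : ∀ {i j} → i + j ≡ 1 → (i ≡ 0 × j ≡ 1) ⊎ (i ≡ 1 × j ≡ 0)
  +≡1-split {zero}                 eq = inj₁ (refl , eq)
  +≡1-split {suc zero}    {zero}   _  = inj₂ (refl , refl)
  +≡1-split {suc zero}    {suc _}  ()
  +≡1-split {suc (suc _)}          ()

  m∣n∧0<n<m+m⇒n≡m : ∀ {d n} → d ℕD.∣ n → 0 < n → n < d + d → n ≡ d
  m∣n∧0<n<m+m⇒n≡m     (divides zero          refl) ()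
  m∣n∧0<n<m+m⇒n≡m {d} (divides (suc zero)    refl) _ _     = ℕP.+-identityʳ d
  m∣n∧0<n<m+m⇒n≡m {d} (divides (suc (suc j)) refl) _ n<d+d =
    ⊥-elim (ℕP.<⇒≱ n<d+d (ℕP.+-monoʳ-≤ d (ℕP.m≤m+n d (j * d))))

data Letter : Set where
  α′ τ′ η′ : Letter

δ : Letter → Letter → ℕ
δ α′ α′ = 1
δ τ′ τ′ = 1
δ η′ η′ = 1
δ _  _  = 0

occ : Letter → List Letter → ℕ
occ ℓ W = sum (map (δ ℓ) W)

αs : ℕ → List Letter
αs n = replicate n α′

τη-word ητ-word : ℕ → ℕ → ℕ → List Letter
τη-word a b c = αs a ++ τ′ ∷ αs b ++ η′ ∷ αs c
ητ-word a b c = αs a ++ η′ ∷ αs b ++ τ′ ∷ αs c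

module _ where
  open import Data.Nat using (_+_; _*_)

  occ-++ : ∀ ℓ V W → occ ℓ (V ++ W) ≡ occ ℓ V + occ ℓ W
  occ-++ ℓ V W = trans (cong sum (map-++ (δ ℓ) V W)) (sum-++ (map (δ ℓ) V) (map (δ ℓ) W))

  occ-↭-++ : ∀ ℓ V₁ V₂ {W} → W ↭ V₁ ++ V₂ → occ ℓ V₁ + occ ℓ V₂ ≡ occ ℓ W
  occ-↭-++ ℓ V₁ V₂ σ = sym (trans (sum-↭ (map⁺ (δ ℓ) σ)) (occ-++ ℓ V₁ V₂))

  occ-αs : ∀ ℓ n → occ ℓ (αs n) ≡ δ ℓ α′ * n
  occ-αs ℓ zero    = sym (ℕP.*-zeroʳ (δ ℓ α′))
  occ-αs ℓ (suc n) = trans (cong (_+_ (δ ℓ α′)) (occ-αs ℓ n)) (sym (ℕP.*-suc (δ ℓ α′) n))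

  occ-τη-word : ∀ ℓ a b c → occ ℓ (τη-word a b c) ≡ δ ℓ α′ * (a + (b + c)) + (δ ℓ τ′ + δ ℓ η′)
  occ-τη-word ℓ a b c = begin
    occ ℓ (αs a ++ τ′ ∷ αs b ++ η′ ∷ αs c)
      ≡⟨ occ-++ ℓ (αs a) _ ⟩
    occ ℓ (αs a) + (δ ℓ τ′ + occ ℓ (αs b ++ η′ ∷ αs c))
      ≡⟨ cong (λ x → occ ℓ (αs a) + (δ ℓ τ′ + x)) (occ-++ ℓ (αs b) _) ⟩
    occ ℓ (αs a) + (δ ℓ τ′ + (occ ℓ (αs b) + (δ ℓ η′ + occ ℓ (αs c))))
      ≡⟨ cong₂ (λ x y → x + (δ ℓ τ′ + y)) (occ-αs ℓ a)
           (cong₂ (λ x y → x + (δ ℓ η′ + y)) (occ-αs ℓ b) (occ-αs ℓ c)) ⟩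
    δ ℓ α′ * a + (δ ℓ τ′ + (δ ℓ α′ * b + (δ ℓ η′ + δ ℓ α′ * c)))
      ≡⟨ regroup (δ ℓ α′) (δ ℓ τ′) (δ ℓ η′) a b c ⟩
    δ ℓ α′ * (a + (b + c)) + (δ ℓ τ′ + δ ℓ η′) ∎
    where
    open ≡-Reasoning
    open import Data.Nat.Tactic.RingSolver using (solve-∀)
    regroup : ∀ d t e a b c → d * a + (t + (d * b + (e + d * c))) ≡ d * (a + (b + c)) + (t + e)
    regroup = solve-∀

  αs-view : ∀ W → occ τ′ W ≡ 0 → occ η′ W ≡ 0 → W ≡ αs (occ α′ W)
  αs-view []       _  _  = refl
  αs-view (α′ ∷ W) hτ hη = cong (α′ ∷_) (αs-view W hτ hη)

  data OneMark (x : Letter) (n : ℕ) : List Letter → Set where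
    one-mark : ∀ b c → b + c ≡ n → OneMark x n (αs b ++ x ∷ αs c)

  single-η : ∀ W → occ τ′ W ≡ 0 → occ η′ W ≡ 1 → OneMark η′ (occ α′ W) W
  single-η (α′ ∷ W) hτ hη with single-η W hτ hη
  ... | one-mark b c eq = one-mark (suc b) c (cong suc eq)
  single-η (η′ ∷ W) hτ hη =
    subst (λ V → OneMark η′ (occ α′ W) (η′ ∷ V)) (sym (αs-view W hτ (ℕP.suc-injective hη)))
      (one-mark 0 (occ α′ W) refl)

  single-τ : ∀ W → occ τ′ W ≡ 1 → occ η′ W ≡ 0 → OneMark τ′ (occ α′ W) W
  single-τ (α′ ∷ W) hτ hη with single-τ W hτ hη
  ... | one-mark b c eq = one-mark (suc b) c (cong suc eq)
  single-τ (τ′ ∷ W) hτ hη =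
    subst (λ V → OneMark τ′ (occ α′ W) (τ′ ∷ V)) (sym (αs-view W (ℕP.suc-injective hτ) hη))
      (one-mark 0 (occ α′ W) refl)

  data TwoMarks (n : ℕ) : List Letter → Set where
    τ-first : ∀ a b c → a + (b + c) ≡ n → TwoMarks n (τη-word a b c)
    η-first : ∀ a b c → a + (b + c) ≡ n → TwoMarks n (ητ-word a b c)

  two-marks : ∀ W → occ τ′ W ≡ 1 → occ η′ W ≡ 1 → TwoMarks (occ α′ W) W
  two-marks (α′ ∷ W) hτ hη with two-marks W hτ hη
  ... | τ-first a b c eq = τ-first (suc a) b c (cong suc eq)
  ... | η-first a b c eq = η-first (suc a) b c (cong suc eq)
  two-marks (τ′ ∷ W) hτ hη with single-η W (ℕP.suc-injective hτ) hη
  ... | one-mark b c eq = τ-first 0 b c eq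
  two-marks (η′ ∷ W) hτ hη with single-τ W hτ (ℕP.suc-injective hη)
  ... | one-mark b c eq = η-first 0 b c eq

module Construction (k m : ℕ) (r : ℤ) where
  open import Data.Integer using (_+_; _-_; _*_; _^_)
  open import Data.Integer.Tactic.RingSolver using (solve-∀)
  import Data.Nat as Nat
  import Data.Nat.Tactic.RingSolver as ℕ-Solver

  p u q : ℕ
  p = 2 Nat.+ k
  u = 1 Nat.+ k
  q = 2 Nat.+ m

  open Fpq p q r

  s : ℤ
  s = r ^ u

  -- η = τ⁻¹ α^(s+1); the exponent s + 1 makes α^(q-1) τ α^(q-1) η the identity.
  η : G
  η = (u , s + 1ℤ)

  ⟦_⟧ : Letter → G
  ⟦ α′ ⟧ = α
  ⟦ τ′ ⟧ = τ
  ⟦ η′ ⟧ = η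

  P : List Letter → G
  P W = prod (map ⟦_⟧ W)

  τ-·ˡ : ∀ t x → τ · (t , x) ≡ (suc t , x)
  τ-·ˡ t x = cong (suc t ,_) (ℤP.+-identityˡ x)

  ·-αsʳ : ∀ g c → g · (0 , + c) ≡ (proj₁ g , proj₂ g + + c)
  ·-αsʳ (t , x) c = cong₂ _,_ (ℕP.+-identityʳ t) (cong (_+ + c) (ℤP.*-identityʳ x))

  P-αs : ∀ c → P (αs c) ≡ (0 , + c)
  P-αs zero    = refl
  P-αs (suc c) = cong (α ·_) (P-αs c)

  P-αs-++ : ∀ a W {t x} → P W ≡ (t , x) → P (αs a ++ W) ≡ (t , + a * r ^ t + x)
  P-αs-++ zero    W {t} {x} PW = trans PW (cong (t ,_) (sym (ℤP.+-identityˡ x)))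
  P-αs-++ (suc a) W {t} {x} PW =
    trans (cong (α ·_) (P-αs-++ a W PW)) (cong (t ,_) (collect (+ a) (r ^ t) x))
    where
    collect : ∀ a y x → 1ℤ * y + (a * y + x) ≡ (1ℤ + a) * y + x
    collect = solve-∀

  P-τη-word : ∀ a b c → P (τη-word a b c) ≡ (p , + a * r ^ p + (+ b * s + (s + 1ℤ + + c)))
  P-τη-word a b c = P-αs-++ a _ (trans (cong (τ ·_) P-αs-++-η) (τ-·ˡ u _))
    where
    P-αs-++-η : P (αs b ++ η′ ∷ αs c) ≡ (u , + b * s + (s + 1ℤ + + c))
    P-αs-++-η = P-αs-++ b _ (trans (cong (η ·_) (P-αs c)) (·-αsʳ η c))

  P-ητ-word : ∀ a b c →
    P (ητ-word a b c) ≡ (u Nat.+ 1 , + a * r ^ (u Nat.+ 1) + ((s + 1ℤ) * r ^ 1 + (+ b * r ^ 1 + + c)))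
  P-ητ-word a b c = P-αs-++ a _ (cong (η ·_) P-αs-++-τ)
    where
    P-αs-++-τ : P (αs b ++ τ′ ∷ αs c) ≡ (1 , + b * r ^ 1 + + c)
    P-αs-++-τ = P-αs-++ b _ (trans (cong (τ ·_) (P-αs c)) (τ-·ˡ 0 (+ c)))

  P-exponent : ∀ W → proj₁ (P W) ≡ occ τ′ W Nat.+ occ η′ W Nat.* u
  P-exponent []       = refl
  P-exponent (α′ ∷ W) = P-exponent W
  P-exponent (τ′ ∷ W) = cong suc (P-exponent W)
  P-exponent (η′ ∷ W) = trans (cong (u Nat.+_) (P-exponent W)) (shift u (occ τ′ W) (occ η′ W))
    where
    shift : ∀ v t n → v Nat.+ (t Nat.+ n Nat.* v) ≡ t Nat.+ suc n Nat.* v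
    shift = ℕ-Solver.solve-∀

  exponent-∣ : ∀ W → P W ≈ e → p ℕD.∣ occ τ′ W Nat.+ occ η′ W Nat.* u
  exponent-∣ W (t≡0 , _) = subst (p ℕD.∣_) (P-exponent W) (mod-zero⁻ {a = + proj₁ (P W)} (mod t≡0))

  τ-without-η : ∀ W → occ τ′ W ≡ 1 → occ η′ W ≡ 0 → ¬ P W ≈ e
  τ-without-η W τW ηW =
    ℕD.>⇒∤ (s≤s (s≤s z≤n)) ∘ subst (p ℕD.∣_) (cong₂ (λ i j → i Nat.+ j Nat.* u) τW ηW) ∘ exponent-∣ W

  η-without-τ : ∀ W → occ τ′ W ≡ 0 → occ η′ W ≡ 1 → ¬ P W ≈ e
  η-without-τ W τW ηW =
    ℕD.>⇒∤ (ℕP.n<1+n u) ∘ subst (p ℕD.∣_) exponent≡u ∘ exponent-∣ W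
    where
    exponent≡u : occ τ′ W Nat.+ occ η′ W Nat.* u ≡ u
    exponent≡u = trans (cong₂ (λ i j → i Nat.+ j Nat.* u) τW ηW) (ℕP.+-identityʳ u)

  αs-product-one : ∀ n → P (αs n) ≈ e → q ℕD.∣ n
  αs-product-one n (_ , x≡0) = mod-zero⁻ (subst (λ g → Mod q (proj₂ g) 0ℤ) (P-αs n) (mod x≡0))

  WS : List Letter
  WS = τη-word (suc m) (suc m) 0

  occ-α-WS : occ α′ WS ≡ suc m Nat.+ suc m
  occ-α-WS = trans (occ-τη-word α′ (suc m) (suc m) 0) (simplify m)
    where
    simplify : ∀ m → 1 Nat.* (suc m Nat.+ (suc m Nat.+ 0)) Nat.+ 0 ≡ suc m Nat.+ suc m
    simplify = ℕ-Solver.solve-∀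

  occ-τ-WS : occ τ′ WS ≡ 1
  occ-τ-WS = occ-τη-word τ′ (suc m) (suc m) 0

  occ-η-WS : occ η′ WS ≡ 1
  occ-η-WS = occ-τη-word η′ (suc m) (suc m) 0

  S : List G
  S = map ⟦_⟧ WS

  length-S : length S ≡ 2 Nat.* q
  length-S = begin
    length S                                     ≡⟨ length-map ⟦_⟧ WS ⟩
    length WS                                    ≡⟨ length-αs-++ (suc m) _ ⟩
    suc m Nat.+ suc (length (αs (suc m) ++ η′ ∷ []))
      ≡⟨ cong (λ n → suc m Nat.+ suc n) (length-αs-++ (suc m) _) ⟩
    suc m Nat.+ suc (suc m Nat.+ 1)              ≡⟨ double m ⟩
    2 Nat.* q                                    ∎
    where
    open ≡-Reasoning
    length-αs-++ : ∀ n W → length (αs n ++ W) ≡ n Nat.+ length W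
    length-αs-++ n W = trans (length-++ (αs n)) (cong (Nat._+ length W) (length-replicate n))
    double : ∀ m → suc m Nat.+ suc (suc m Nat.+ 1) ≡ 2 Nat.* (2 Nat.+ m)
    double = ℕ-Solver.solve-∀

  module Minimality (q-prime : Prime q) (rᵖ≡1 : Mod q (r ^ p) 1ℤ) (r≢1 : ¬ Mod q r 1ℤ) where
    open SetoidReasoning (mod-setoid q)

    s≢1 : ¬ Mod q s 1ℤ
    s≢1 s≡1 = r≢1 (begin
      r        ≡⟨ ℤP.*-identityʳ r ⟨
      r * 1ℤ   ≈⟨ mod-*-congˡ r (mod-sym s≡1) ⟩
      r * s    ≈⟨ rᵖ≡1 ⟩
      1ℤ       ∎)

    rᵖ-absorb : ∀ x y → Mod q (x * r ^ p + y) (x + y)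
    rᵖ-absorb x y = begin
      x * r ^ p + y  ≈⟨ mod-+-congʳ y (mod-*-congˡ x rᵖ≡1) ⟩
      x * 1ℤ + y     ≡⟨ cong (_+ y) (ℤP.*-identityʳ x) ⟩
      x + y          ∎

    τη-word-α : ∀ a b c →
      Mod q (proj₂ (P (τη-word a b c))) (+ (2 Nat.+ (a Nat.+ (b Nat.+ c))) + + suc b * (s - 1ℤ))
    τη-word-α a b c = begin
      proj₂ (P (τη-word a b c))                 ≡⟨ cong proj₂ (P-τη-word a b c) ⟩
      + a * r ^ p + (+ b * s + (s + 1ℤ + + c))  ≈⟨ rᵖ-absorb (+ a) _ ⟩
      + a + (+ b * s + (s + 1ℤ + + c))          ≡⟨ regroup (+ a) (+ b) (+ c) s ⟩
      + (2 Nat.+ (a Nat.+ (b Nat.+ c))) + + suc b * (s - 1ℤ) ∎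
      where
      regroup : ∀ a b c s →
        a + (b * s + (s + 1ℤ + c)) ≡ (+ 2 + (a + (b + c))) + (1ℤ + b) * (s - 1ℤ)
      regroup = solve-∀

    ητ-word-α : ∀ a b c →
      Mod q (proj₂ (P (ητ-word a b c))) (+ (2 Nat.+ (a Nat.+ (b Nat.+ c))) + + suc b * (r - 1ℤ))
    ητ-word-α a b c = begin
      proj₂ (P (ητ-word a b c))
        ≡⟨ cong proj₂ (P-ητ-word a b c) ⟩
      + a * r ^ (u Nat.+ 1) + ((s + 1ℤ) * r ^ 1 + (+ b * r ^ 1 + + c))
        ≡⟨ cong₂ (λ x y → + a * x + ((s + 1ℤ) * y + (+ b * y + + c)))
                 (cong (r ^_) (ℕP.+-comm u 1)) (ℤP.^-identityʳ r) ⟩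
      + a * (r * s) + ((s + 1ℤ) * r + (+ b * r + + c))
        ≡⟨ collect (+ a) (+ b) (+ c) r s ⟩
      (+ a + 1ℤ) * r ^ p + (+ b * r + (r + + c))
        ≈⟨ rᵖ-absorb (+ a + 1ℤ) _ ⟩
      (+ a + 1ℤ) + (+ b * r + (r + + c))
        ≡⟨ regroup (+ a) (+ b) (+ c) r ⟩
      + (2 Nat.+ (a Nat.+ (b Nat.+ c))) + + suc b * (r - 1ℤ) ∎
      where
      collect : ∀ a b c r s →
        a * (r * s) + ((s + 1ℤ) * r + (b * r + c)) ≡ (a + 1ℤ) * (r * s) + (b * r + (r + c))
      collect = solve-∀
      regroup : ∀ a b c r →
        (a + 1ℤ) + (b * r + (r + c)) ≡ (+ 2 + (a + (b + c))) + (1ℤ + b) * (r - 1ℤ)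
      regroup = solve-∀

    residue-nonzero : ∀ a b c z {x} → a Nat.+ (b Nat.+ c) ≡ m → ¬ Mod q z 0ℤ →
      Mod q x (+ (2 Nat.+ (a Nat.+ (b Nat.+ c))) + + suc b * z) → ¬ Mod q x 0ℤ
    residue-nonzero a b c z {x} sum≡m z≢0 x≡ x≡0 =
      [ q∤1+b , z≢0 ] (mod-euclid q-prime (+ suc b) z (begin
        + suc b * z                                      ≡⟨ ℤP.+-identityˡ _ ⟨
        0ℤ + + suc b * z                                 ≈⟨ mod-+-congʳ (+ suc b * z) mod-self ⟨
        + q + + suc b * z                                ≡⟨ cong (λ n → + (2 Nat.+ n) + + suc b * z) sum≡m ⟨
        + (2 Nat.+ (a Nat.+ (b Nat.+ c))) + + suc b * z  ≈⟨ x≡ ⟨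
        x                                                ≈⟨ x≡0 ⟩
        0ℤ                                               ∎))
      where
      b≤m : b Nat.≤ m
      b≤m = subst (b Nat.≤_) sum≡m (ℕP.≤-trans (ℕP.m≤m+n b c) (ℕP.m≤n+m (b Nat.+ c) a))
      q∤1+b : ¬ Mod q (+ suc b) 0ℤ
      q∤1+b = ℕD.>⇒∤ (s≤s (s≤s b≤m)) ∘ mod-zero⁻

    two-marks-not-product-one : ∀ W → occ α′ W ≡ m → occ τ′ W ≡ 1 → occ η′ W ≡ 1 → ¬ P W ≈ e
    two-marks-not-product-one W αW τW ηW (_ , x≡0) with two-marks W τW ηW
    ... | τ-first a b c eq =
      residue-nonzero a b c (s - 1ℤ) (trans eq αW) (s≢1 ∘ mod-diff⁻) (τη-word-α a b c) (mod x≡0)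
    ... | η-first a b c eq =
      residue-nonzero a b c (r - 1ℤ) (trans eq αW) (r≢1 ∘ mod-diff⁻) (ητ-word-α a b c) (mod x≡0)

    pure-and-full : ∀ Y X → Y ≢ [] → occ τ′ Y ≡ 0 → occ η′ Y ≡ 0 → occ τ′ X ≡ 1 → occ η′ X ≡ 1 →
      occ α′ Y Nat.+ occ α′ X ≡ suc m Nat.+ suc m → P Y ≈ e → P X ≈ e → ⊥
    pure-and-full Y X Y≢[] τY ηY τX ηX αYX peY = two-marks-not-product-one X αX τX ηX
      where
      Y≡αs : Y ≡ αs (occ α′ Y)
      Y≡αs = αs-view Y τY ηY
      αY>0 : 0 < occ α′ Y
      αY>0 = ℕP.n≢0⇒n>0 (λ αY≡0 → Y≢[] (trans Y≡αs (cong αs αY≡0)))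
      αY<q+q : occ α′ Y < q Nat.+ q
      αY<q+q = ℕP.≤-<-trans (ℕP.m≤m+n _ (occ α′ X))
        (subst (Nat._< q Nat.+ q) (sym αYX) (ℕP.+-mono-< (ℕP.n<1+n (suc m)) (ℕP.n<1+n (suc m))))
      αY≡q : occ α′ Y ≡ q
      αY≡q = m∣n∧0<n<m+m⇒n≡m (αs-product-one _ (subst (λ V → P V ≈ e) Y≡αs peY)) αY>0 αY<q+q
      αX : occ α′ X ≡ m
      αX = ℕP.+-cancelˡ-≡ q _ _
             (trans (cong (Nat._+ occ α′ X) (sym αY≡q)) (trans αYX (cong suc (ℕP.+-suc m m))))

    no-product-one-split : ∀ {V₁ V₂} → WS ↭ V₁ ++ V₂ → V₁ ≢ [] → V₂ ≢ [] → P V₁ ≈ e → P V₂ ≈ e → ⊥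
    no-product-one-split {V₁} {V₂} σ V₁≢[] V₂≢[] pe₁ pe₂
      with +≡1-split (trans (occ-↭-++ τ′ V₁ V₂ σ) occ-τ-WS)
         | +≡1-split (trans (occ-↭-++ η′ V₁ V₂ σ) occ-η-WS)
    ... | inj₁ (τ₁ , τ₂) | inj₁ (η₁ , η₂) =
      pure-and-full V₁ V₂ V₁≢[] τ₁ η₁ τ₂ η₂ (trans (occ-↭-++ α′ V₁ V₂ σ) occ-α-WS) pe₁ pe₂
    ... | inj₂ (τ₁ , τ₂) | inj₂ (η₁ , η₂) =
      pure-and-full V₂ V₁ V₂≢[] τ₂ η₂ τ₁ η₁
        (trans (ℕP.+-comm (occ α′ V₂) (occ α′ V₁)) (trans (occ-↭-++ α′ V₁ V₂ σ) occ-α-WS)) pe₂ pe₁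
    ... | inj₁ (τ₁ , _) | inj₂ (η₁ , _) = η-without-τ V₁ τ₁ η₁ pe₁
    ... | inj₂ (τ₁ , _) | inj₁ (η₁ , _) = τ-without-η V₁ τ₁ η₁ pe₁

    S-product-one : prod S ≈ e
    S-product-one = unmod exponent-part , unmod α-part
      where
      exponent-part : Mod p (+ proj₁ (P WS)) 0ℤ
      exponent-part =
        subst (λ t → Mod p (+ t) 0ℤ) (sym (cong proj₁ (P-τη-word (suc m) (suc m) 0))) mod-self
      α-part : Mod q (proj₂ (P WS)) 0ℤ
      α-part = begin
        proj₂ (P WS)                                             ≈⟨ τη-word-α (suc m) (suc m) 0 ⟩
        + (2 Nat.+ (suc m Nat.+ (suc m Nat.+ 0))) + + q * (s - 1ℤ)
          ≈⟨ mod-+-cong (∣⇒mod-zero (divides 2 (double m))) (mod-*-congʳ (s - 1ℤ) mod-self) ⟩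
        0ℤ                                                       ∎
        where
        double : ∀ m → 2 Nat.+ (suc m Nat.+ (suc m Nat.+ 0)) ≡ 2 Nat.* (2 Nat.+ m)
        double = ℕ-Solver.solve-∀

    S-minimal : MinimalProductOne S
    S-minimal = (λ ()) , (S , ↭-refl , S-product-one) , no-split
      where
      nonempty : ∀ {V X} → map ⟦_⟧ V ↭ X → X ≢ [] → V ≢ []
      nonempty ρ X≢[] refl = X≢[] (↭-empty-inv (↭-sym ρ))
      no-split : ¬ (∃[ T ] ∃[ U ] (S ↭ T ++ U × T ≢ [] × U ≢ [] × ProductOne T × ProductOne U))
      no-split (T , U , σ , T≢[] , U≢[] , (T′ , T′↭T , pe₁) , (U′ , U′↭U , pe₂))
        with V₁ , V₂ , ρ , refl , refl ←
               ↭-map-++⁻ ⟦_⟧ {ys = T′} (↭-trans σ (++⁺ (↭-sym T′↭T) (↭-sym U′↭U)))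
        = no-product-one-split ρ (nonempty T′↭T T≢[]) (nonempty U′↭U U≢[]) pe₁ pe₂

open import Data.Nat using (_*_; _∸_)
open import Data.Nat.Divisibility using (_∣_)
open import Data.Integer using (_^_)

lemma5p2 : (p q : ℕ) → Prime p → Prime q → p ∣ (q ∸ 1) →
    (r : ℤ) → (r ^ p) ≡ (+ 1) [mod q ] → ¬ (r ≡ (+ 1) [mod q ]) →
    Fpq.D≥ p q r (2 * q)
lemma5p2 (suc (suc k)) (suc (suc m)) _ q-prime _ r rᵖ≡1 r≢1 =
  S , S-minimal , ℕP.≤-reflexive (sym length-S)
  where
  open Construction k m r
  open Minimality q-prime (mod rᵖ≡1) (r≢1 ∘ unmod)
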